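{- Let $k,m,n\ge1$, let $\mu$ be a measure on $[k]$, and for $1\le i\le n$ let $a^i_1,\dots,a^i_m\subseteq[k]$. Then $$p_1\Big(\bigcup_{i=1}^n\{a^i_1,\dots,a^i_m\}\Big)=\frac{1}{(m!)^{n-1}}\sum_{\sigma\in\{\mathrm{id}\}\times S_m^{n-1}}\ \sum_{j=1}^{m}\ \sum_{\emptyset\ne I\subseteq[n]}(-1)^{|I|+1}\mu\Big(\bigcap_{i\in I}a^i_{\sigma_i(j)}\Big),$$ where $\sigma=(\sigma_1,\dots,\sigma_n)$ with $\sigma_1=\mathrm{id}$.
   Context: Work over $\mathbb{R}$. $[k]=\{1,\dots,k\}$; $\langle P[k]\rangle$ is the real vector space with basis the subsets of $[k]$, with union the bilinear extension of set union; $\langle P[k]\rangle^{\otimes m}$ has componentwise union and $S_m$ permutes tensor factors. $\mathrm{Sym}^m\langle P[k]\rangle=\langle P[k]\rangle^{\otimes m}/S_m$ (coinvariants), $\{a_1,\dots,a_m\}$ denotes the class of $a_1\otimes\cdots\otimes a_m$, union on it is $\bar u\cup\bar v=\frac{1}{m!}\sum_{\tau\in S_m}\overline{u\cup\tau v}$, and $\bigcup_{i=1}^n$ is the iterated union. A measure on $[k]$ is a map $\mu:P([k])\to\mathbb{R}$ with $\mu(a\cup b)=\mu(a)+\mu(b)$ for disjoint $a,b$. $p_1:\mathrm{Sym}^m\langle P[k]\rangle\to\mathbb{R}$ is the linear map with $p_1(\{a_1,\dots,a_m\})=\sum_{i=1}^m\mu(a_i)$.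
   Formalization: The measure μ takes values in ℚ rather than ℝ, and the vector space with basis the subsets of [k], together with its symmetric power, is taken over ℚ. -}

module Defs where

open import Data.Bool using (Bool; true; false; if_then_else_; not; _∨_; _∧_)
open import Data.Nat as ℕ using (ℕ; zero; suc; _∸_; _^_; _!; _≤ᵇ_)
open import Data.Nat.Properties using (m^n≢0; _!≢0)
open import Data.Integer using (+_)
open import Data.Fin using (Fin; zero; suc; _≟_)
open import Data.Fin.Subset using (Subset; inside; outside; _∩_; _∪_; ⊥; ⊤; ∣_∣)
open import Data.Vec using (Vec; []; _∷_; lookup)
open import Data.List using (List; []; _∷_; [_]; map; concatMap; foldr; foldl; allFin; filterᵇ)
open import Data.Product using (_×_; _,_)
open import Data.Rational using (ℚ; 0ℚ; 1ℚ; _+_; _*_; -_; _/_)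
open import Relation.Nullary using (does)
open import Relation.Binary.PropositionalEquality using (_≡_)
open import Function using (_∘_; id)

Disjoint : {k : ℕ} → Subset k → Subset k → Set
Disjoint a b = a ∩ b ≡ ⊥

IsMeasure : {k : ℕ} → (Subset k → ℚ) → Set
IsMeasure {k} μ = (a b : Subset k) → Disjoint a b → μ (a ∪ b) ≡ μ a + μ b

sumℚ : List ℚ → ℚ
sumℚ = foldr _+_ 0ℚ

allVecs : (m r : ℕ) → List (Vec (Fin m) r)
allVecs m zero    = [ [] ]
allVecs m (suc r) = concatMap (λ i → map (i ∷_) (allVecs m r)) (allFin m)

allᵇ : {A : Set} → (A → Bool) → List A → Bool
allᵇ p = foldr (λ x b → p x ∧ b) true

isInjective : {m : ℕ} → (Fin m → Fin m) → Bool
isInjective {m} f =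
  allᵇ (λ i → allᵇ (λ j → not (does (f i ≟ f j)) ∨ does (i ≟ j)) (allFin m)) (allFin m)

-- S_m, listed without repetition
perms : (m : ℕ) → List (Fin m → Fin m)
perms m = filterᵇ isInjective (map lookup (allVecs m m))

-- <P[k]>^{⊗ m}: formal ℚ-linear combinations of m-tuples of subsets.
-- Sym^m<P[k]> is the quotient by S_m; its elements are represented by
-- tensors (classes of representatives).

Tensor : ℕ → ℕ → Set
Tensor k m = List (ℚ × (Fin m → Subset k))

pureT : {k m : ℕ} → (Fin m → Subset k) → Tensor k m
pureT a = [ (1ℚ , a) ]

scaleT : {k m : ℕ} → ℚ → Tensor k m → Tensor k m
scaleT c = map (λ { (d , x) → (c * d , x) })

_∪ᵗ_ : {k m : ℕ} → Tensor k m → Tensor k m → Tensor k m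
u ∪ᵗ v = concatMap (λ { (c , x) → map (λ { (d , y) → (c * d , λ j → x j ∪ y j) }) v }) u

permuteT : {k m : ℕ} → (Fin m → Fin m) → Tensor k m → Tensor k m
permuteT τ = map (λ { (c , y) → (c , y ∘ τ) })

_∪ˢ_ : {k m : ℕ} → Tensor k m → Tensor k m → Tensor k m
_∪ˢ_ {k} {m} u v =
  scaleT ((+ 1 / (m !)) {{m !≢0}}) (concatMap (λ τ → u ∪ᵗ permuteT τ v) (perms m))

-- iterated union x_1 ∪ x_2 ∪ ... ∪ x_n (left-associated); the empty case is
-- never used (n ≥ 1)
iterUnion : {k m : ℕ} → List (Tensor k m) → Tensor k m
iterUnion []       = pureT (λ _ → ⊥)
iterUnion (x ∷ xs) = foldl _∪ˢ_ x xs

p₁ : {k m : ℕ} → (Subset k → ℚ) → Tensor k m → ℚ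
p₁ {k} {m} μ t = sumℚ (map (λ { (c , y) → c * sumℚ (map (μ ∘ y) (allFin m)) }) t)

consF : {A : Set} {r : ℕ} → A → (Fin r → A) → Fin (suc r) → A
consF x f zero    = x
consF x f (suc i) = f i

permTuples : (m r : ℕ) → List (Fin r → Fin m → Fin m)
permTuples m zero    = [ (λ ()) ]
permTuples m (suc r) = concatMap (λ τ → map (consF τ) (permTuples m r)) (perms m)

sigmas : (m n : ℕ) → List (Fin n → Fin m → Fin m)
sigmas m zero    = [ (λ ()) ]
sigmas m (suc r) = map (consF id) (permTuples m r)

allSubsets : (n : ℕ) → List (Subset n)
allSubsets zero    = [ [] ]
allSubsets (suc n) = concatMap (λ s → (inside ∷ s) ∷ (outside ∷ s) ∷ []) (allSubsets n)

nonemptySubsets : (n : ℕ) → List (Subset n)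
nonemptySubsets n = filterᵇ (λ I → 1 ≤ᵇ ∣ I ∣) (allSubsets n)

-- ⋂_{i ∈ I} f i  (⊤ = [k] for I empty; only used for I nonempty)
bigInter : {k n : ℕ} → Subset n → (Fin n → Subset k) → Subset k
bigInter {k} {n} I f = foldr (λ i acc → if lookup I i then f i ∩ acc else acc) ⊤ (allFin n)

signℚ : ℕ → ℚ
signℚ zero    = 1ℚ
signℚ (suc r) = - signℚ r

rhs : {k : ℕ} (m n : ℕ) → (Subset k → ℚ) → (Fin n → Fin m → Subset k) → ℚ
rhs m n μ a =
  (+ 1 / ((m !) ^ (n ∸ 1))) {{m^n≢0 (m !) (n ∸ 1) {{m !≢0}}}}
  * sumℚ (map (λ σ → sumℚ (map (λ j → sumℚ (map (λ I →
        signℚ (∣ I ∣ ℕ.+ 1) * μ (bigInter I (λ i → a i (σ i j))))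
      (nonemptySubsets n))) (allFin m))) (sigmas m n))

{-# OPTIONS --safe #-}
-- Unfolding the symmetrised union, the iterated union of the classes {a^i} is
-- 1/(m!)^(n-1) times the sum, over σ ∈ {id} × S_m^(n-1), of the pure tensors whose
-- j-th factor is ⋃_i a^i_{σ_i(j)}: each of the n - 1 unions contributes a factor
-- 1/m! and a sum over S_m. As p₁ is linear and sends a pure tensor to the sum of
-- the measures of its factors, what remains is inclusion–exclusion
-- μ(⋃_i b_i) = Σ_{∅≠I} (-1)^(|I|+1) μ(⋂_{i∈I} b_i) for a finitely additive μ.
-- It follows from Σ_I (-1)^|I| μ(X ∩ ⋂_{i∈I} b_i) = μ(X ∩ ⋂_i ∁ b_i), proved by
-- induction on n for all X at once by splitting X along b_1.

module Submission where

open import Defs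
open import Data.Nat using (ℕ; _≤_)
open import Data.Fin using (Fin)
open import Data.Fin.Subset using (Subset)
open import Data.Rational using (ℚ)
open import Data.List using (map; allFin)
open import Relation.Binary.PropositionalEquality using (_≡_)

import Algebra.Lattice.Properties.BooleanAlgebra as BooleanAlgebra
import Algebra.Solver.IdempotentCommutativeMonoid as ICM-Solver
open import Data.Bool using (true; false; if_then_else_)
open import Data.Nat as ℕ using (zero; suc; _!; _^_; NonZero)
open import Data.Nat.Properties using (_!≢0; m^n≢0; m*n≢0; +-comm)
import Data.Integer as ℤ
open import Data.Fin using (zero; suc)
open import Data.Fin.Subset using (inside; outside; _∩_; _∪_; ∁; ⊥; ⊤; ⋃; ⋂; ∣_∣)
open import Data.Fin.Subset.Properties
  using (∩-assoc; ∩-identityˡ; ∩-identityʳ; ∩-zeroʳ; ∪-identityʳ; ∪-assoc; ∪-inverseʳ; ∩-inverseʳ;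
         ∩-distribˡ-∪; ∣⊥∣≡0; ∩-idempotentCommutativeMonoid; ∪-∩-booleanAlgebra)
open import Data.Vec using (_∷_; lookup)
open import Data.List using (List; []; _∷_; _++_; foldr; foldl; concatMap; tabulate; filterᵇ)
import Data.List.Properties as List
open import Data.Product using (_×_; _,_)
open import Data.Rational using (0ℚ; 1ℚ; _+_; _*_; -_; _-_; _/_; fromℚᵘ; toℚᵘ)
open import Data.Rational.Properties
  using (+-identityˡ; +-identityʳ; *-identityˡ; *-identityʳ; *-zeroʳ; +-assoc; *-assoc; *-comm;
         *-distribˡ-+; neg-distrib-+; neg-distribˡ-*; fromℚᵘ-cong; fromℚᵘ-toℚᵘ; toℚᵘ-fromℚᵘ;
         toℚᵘ-homo-*)
import Data.Rational.Unnormalised as ℚᵘ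
import Data.Rational.Unnormalised.Properties as ℚᵘ
open import Data.Rational.Solver using (module +-*-Solver)
open +-*-Solver using (solve; _:+_; _:-_; :-_; _:=_)
open import Function using (_∘_; id)
open import Relation.Binary.PropositionalEquality
  using (refl; sym; trans; cong; cong₂; module ≡-Reasoning)

open ≡-Reasoning

sumℚ-++ : (xs ys : List ℚ) → sumℚ (xs ++ ys) ≡ sumℚ xs + sumℚ ys
sumℚ-++ []       ys = sym (+-identityˡ _)
sumℚ-++ (x ∷ xs) ys = trans (cong (x +_) (sumℚ-++ xs ys)) (sym (+-assoc x _ _))

module _ {A : Set} where

  sumℚ-map-cong : {f g : A → ℚ} → (∀ x → f x ≡ g x) → ∀ xs → sumℚ (map f xs) ≡ sumℚ (map g xs)
  sumℚ-map-cong f≗g xs = cong sumℚ (List.map-cong f≗g xs)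

  sumℚ-map-+ : ∀ (f g : A → ℚ) xs →
    sumℚ (map (λ x → f x + g x) xs) ≡ sumℚ (map f xs) + sumℚ (map g xs)
  sumℚ-map-+ f g []       = refl
  sumℚ-map-+ f g (x ∷ xs) = trans (cong (f x + g x +_) (sumℚ-map-+ f g xs))
    (solve 4 (λ a b c d → (a :+ b) :+ (c :+ d) := (a :+ c) :+ (b :+ d)) refl
      (f x) (g x) (sumℚ (map f xs)) (sumℚ (map g xs)))

  sumℚ-map-*ˡ : ∀ c (f : A → ℚ) xs → sumℚ (map (λ x → c * f x) xs) ≡ c * sumℚ (map f xs)
  sumℚ-map-*ˡ c f []       = sym (*-zeroʳ c)
  sumℚ-map-*ˡ c f (x ∷ xs) = trans (cong (c * f x +_) (sumℚ-map-*ˡ c f xs)) (sym (*-distribˡ-+ c _ _))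

  sumℚ-map-neg : ∀ (f : A → ℚ) xs → sumℚ (map (λ x → - f x) xs) ≡ - sumℚ (map f xs)
  sumℚ-map-neg f []       = refl
  sumℚ-map-neg f (x ∷ xs) = trans (cong (- f x +_) (sumℚ-map-neg f xs)) (sym (neg-distrib-+ (f x) _))

  sumℚ-map-filterᵇ : ∀ p (f : A → ℚ) xs →
    sumℚ (map f (filterᵇ p xs)) ≡ sumℚ (map (λ x → if p x then f x else 0ℚ) xs)
  sumℚ-map-filterᵇ p f [] = refl
  sumℚ-map-filterᵇ p f (x ∷ xs) with p x
  ... | true  = cong (f x +_) (sumℚ-map-filterᵇ p f xs)
  ... | false = trans (sumℚ-map-filterᵇ p f xs) (sym (+-identityˡ _))

module _ {A B : Set} where

  sumℚ-map-∘ : ∀ (g : B → ℚ) (f : A → B) xs → sumℚ (map (g ∘ f) xs) ≡ sumℚ (map g (map f xs))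
  sumℚ-map-∘ g f xs = cong sumℚ (List.map-∘ xs)

  sumℚ-map-concatMap : ∀ (g : B → ℚ) (f : A → List B) xs →
    sumℚ (map g (concatMap f xs)) ≡ sumℚ (map (λ x → sumℚ (map g (f x))) xs)
  sumℚ-map-concatMap g f []       = refl
  sumℚ-map-concatMap g f (x ∷ xs) = begin
    sumℚ (map g (f x ++ concatMap f xs))            ≡⟨ cong sumℚ (List.map-++ g (f x) _) ⟩
    sumℚ (map g (f x) ++ map g (concatMap f xs))    ≡⟨ sumℚ-++ (map g (f x)) _ ⟩
    sumℚ (map g (f x)) + sumℚ (map g (concatMap f xs))
      ≡⟨ cong (sumℚ (map g (f x)) +_) (sumℚ-map-concatMap g f xs) ⟩
    sumℚ (map g (f x)) + sumℚ (map (λ x → sumℚ (map g (f x))) xs) ∎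

  sumℚ-map-swap : ∀ (g : A → B → ℚ) xs ys →
    sumℚ (map (λ x → sumℚ (map (g x) ys)) xs) ≡ sumℚ (map (λ y → sumℚ (map (λ x → g x y) xs)) ys)
  sumℚ-map-swap g []       ys = sym (sumℚ-map-0 ys)
    where
    sumℚ-map-0 : ∀ (ys : List B) → sumℚ (map (λ _ → 0ℚ) ys) ≡ 0ℚ
    sumℚ-map-0 []       = refl
    sumℚ-map-0 (_ ∷ ys) = trans (+-identityˡ _) (sumℚ-map-0 ys)
  sumℚ-map-swap g (x ∷ xs) ys =
    trans (cong (sumℚ (map (g x) ys) +_) (sumℚ-map-swap g xs ys))
          (sym (sumℚ-map-+ (g x) (λ y → sumℚ (map (λ x → g x y) xs)) ys))

bigInter-∷ : ∀ {k n} x (I : Subset n) (f : Fin (suc n) → Subset k) →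
  bigInter (x ∷ I) f ≡ (if x then f zero ∩ bigInter I (f ∘ suc) else bigInter I (f ∘ suc))
bigInter-∷ {n = n} x I f =
  cong (λ acc → if x then f zero ∩ acc else acc)
    (trans (cong (foldr step ⊤) (sym (List.map-tabulate id suc)))
           (List.foldr-map step suc ⊤ (allFin n)))
  where step = λ i acc → if lookup (x ∷ I) i then f i ∩ acc else acc

bigInter-⊥ : ∀ {k n} (f : Fin n → Subset k) → bigInter ⊥ f ≡ ⊤
bigInter-⊥ {n = zero}  f = refl
bigInter-⊥ {n = suc n} f = trans (bigInter-∷ outside ⊥ f) (bigInter-⊥ (f ∘ suc))

∁-⋃-tabulate : ∀ {k n} (f : Fin n → Subset k) → ∁ (⋃ (tabulate f)) ≡ ⋂ (tabulate (∁ ∘ f))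
∁-⋃-tabulate {k} {zero}  f = BooleanAlgebra.¬⊥≈⊤ (∪-∩-booleanAlgebra k)
∁-⋃-tabulate {k} {suc n} f =
  trans (BooleanAlgebra.deMorgan₂ (∪-∩-booleanAlgebra k) (f zero) _)
        (cong (∁ (f zero) ∩_) (∁-⋃-tabulate (f ∘ suc)))

sumℚ-allSubsets-suc : ∀ {n} (g : Subset (suc n) → ℚ) →
  sumℚ (map g (allSubsets (suc n))) ≡ sumℚ (map (λ I → g (inside ∷ I) + g (outside ∷ I)) (allSubsets n))
sumℚ-allSubsets-suc {n} g =
  trans (sumℚ-map-concatMap g (λ I → (inside ∷ I) ∷ (outside ∷ I) ∷ []) (allSubsets n))
        (sumℚ-map-cong (λ I → cong (g (inside ∷ I) +_) (+-identityʳ _)) (allSubsets n))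

sumℚ-allSubsets : ∀ {n} (g : Subset n → ℚ) →
  sumℚ (map g (allSubsets n)) ≡ g ⊥ + sumℚ (map g (nonemptySubsets n))
sumℚ-allSubsets {n} g =
  trans (split n g) (cong (g ⊥ +_) (sym (sumℚ-map-filterᵇ (λ I → 1 ℕ.≤ᵇ ∣ I ∣) g (allSubsets n))))
  where
  ifNonempty : ∀ {n} → (Subset n → ℚ) → Subset n → ℚ
  ifNonempty g I = if 1 ℕ.≤ᵇ ∣ I ∣ then g I else 0ℚ

  split : ∀ n (g : Subset n → ℚ) →
    sumℚ (map g (allSubsets n)) ≡ g ⊥ + sumℚ (map (ifNonempty g) (allSubsets n))
  split zero    g = refl
  split (suc n) g = begin
    sumℚ (map g (allSubsets (suc n)))
      ≡⟨ sumℚ-allSubsets-suc g ⟩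
    sumℚ (map (λ I → g (inside ∷ I) + g (outside ∷ I)) (allSubsets n))
      ≡⟨ sumℚ-map-+ g-in g-out (allSubsets n) ⟩
    Σ g-in + Σ g-out
      ≡⟨ cong (Σ g-in +_) (split n g-out) ⟩
    Σ g-in + (g ⊥ + Σ (ifNonempty g-out))
      ≡⟨ solve 3 (λ a b c → a :+ (b :+ c) := b :+ (a :+ c)) refl (Σ g-in) (g ⊥) (Σ (ifNonempty g-out)) ⟩
    g ⊥ + (Σ g-in + Σ (ifNonempty g-out))
      ≡⟨ cong (g ⊥ +_) (sumℚ-map-+ g-in (ifNonempty g-out) (allSubsets n)) ⟨
    g ⊥ + sumℚ (map (λ I → g (inside ∷ I) + ifNonempty g-out I) (allSubsets n))
      ≡⟨ cong (g ⊥ +_) (sumℚ-allSubsets-suc (ifNonempty g)) ⟨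
    g ⊥ + sumℚ (map (ifNonempty g) (allSubsets (suc n))) ∎
    where
    g-in g-out : Subset n → ℚ
    g-in  I = g (inside ∷ I)
    g-out I = g (outside ∷ I)
    Σ : (Subset n → ℚ) → ℚ
    Σ h = sumℚ (map h (allSubsets n))

signℚ-+1 : ∀ r → signℚ (r ℕ.+ 1) ≡ - signℚ r
signℚ-+1 r = cong signℚ (+-comm r 1)

module _ {k : ℕ} {μ : Subset k → ℚ} (μ-additive : IsMeasure μ) where

  μ-split : ∀ Y Z → μ Y ≡ μ (Y ∩ Z) + μ (Y ∩ ∁ Z)
  μ-split Y Z = begin
    μ Y                             ≡⟨ cong μ (sym (trans (cong (Y ∩_) (∪-inverseʳ Z)) (∩-identityʳ Y))) ⟩
    μ (Y ∩ (Z ∪ ∁ Z))               ≡⟨ cong μ (∩-distribˡ-∪ Y Z (∁ Z)) ⟩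
    μ ((Y ∩ Z) ∪ (Y ∩ ∁ Z))         ≡⟨ μ-additive (Y ∩ Z) (Y ∩ ∁ Z) disjoint ⟩
    μ (Y ∩ Z) + μ (Y ∩ ∁ Z)         ∎
    where
    open ICM-Solver (∩-idempotentCommutativeMonoid k) using (_⊕_; _⊜_) renaming (solve to solve-∩)
    disjoint : (Y ∩ Z) ∩ (Y ∩ ∁ Z) ≡ ⊥
    disjoint = begin
      (Y ∩ Z) ∩ (Y ∩ ∁ Z)  ≡⟨ solve-∩ 3 (λ y z z′ → (y ⊕ z) ⊕ (y ⊕ z′) ⊜ y ⊕ (z ⊕ z′)) refl Y Z (∁ Z) ⟩
      Y ∩ (Z ∩ ∁ Z)        ≡⟨ cong (Y ∩_) (∩-inverseʳ Z) ⟩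
      Y ∩ ⊥                ≡⟨ ∩-zeroʳ Y ⟩
      ⊥                    ∎

  μ-∩-⋂∁ : ∀ n (f : Fin n → Subset k) X →
    μ (X ∩ ⋂ (tabulate (∁ ∘ f))) ≡ sumℚ (map (λ I → signℚ ∣ I ∣ * μ (X ∩ bigInter I f)) (allSubsets n))
  μ-∩-⋂∁ zero    f X = sym (trans (+-identityʳ _) (*-identityˡ _))
  μ-∩-⋂∁ (suc n) f X = begin
    μ (X ∩ (∁ (f zero) ∩ R))
      ≡⟨ solve 2 (λ a b → b := (:- a) :+ (a :+ b)) refl (μ ((X ∩ f zero) ∩ R)) (μ (X ∩ (∁ (f zero) ∩ R))) ⟩
    - μ ((X ∩ f zero) ∩ R) + (μ ((X ∩ f zero) ∩ R) + μ (X ∩ (∁ (f zero) ∩ R)))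
      ≡⟨ cong (- μ ((X ∩ f zero) ∩ R) +_) (sym (μ-split-along-f₀)) ⟩
    - μ ((X ∩ f zero) ∩ R) + μ (X ∩ R)
      ≡⟨ cong₂ (λ a b → - a + b) (μ-∩-⋂∁ n (f ∘ suc) (X ∩ f zero)) (μ-∩-⋂∁ n (f ∘ suc) X) ⟩
    - sumℚ (map (term (X ∩ f zero)) (allSubsets n)) + sumℚ (map (term X) (allSubsets n))
      ≡⟨ cong (_+ sumℚ (map (term X) (allSubsets n))) (sumℚ-map-neg (term (X ∩ f zero)) (allSubsets n)) ⟨
    sumℚ (map (λ I → - term (X ∩ f zero) I) (allSubsets n)) + sumℚ (map (term X) (allSubsets n))
      ≡⟨ sym (sumℚ-map-+ (λ I → - term (X ∩ f zero) I) (term X) (allSubsets n)) ⟩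
    sumℚ (map (λ I → - term (X ∩ f zero) I + term X I) (allSubsets n))
      ≡⟨ sumℚ-map-cong (λ I → cong₂ _+_ (inside-term I) (outside-term I)) (allSubsets n) ⟨
    sumℚ (map (λ I → g (inside ∷ I) + g (outside ∷ I)) (allSubsets n))
      ≡⟨ sumℚ-allSubsets-suc g ⟨
    sumℚ (map g (allSubsets (suc n))) ∎
    where
    R = ⋂ (tabulate (∁ ∘ f ∘ suc))
    g : Subset (suc n) → ℚ
    g I = signℚ ∣ I ∣ * μ (X ∩ bigInter I f)
    term : Subset k → Subset n → ℚ
    term Y I = signℚ ∣ I ∣ * μ (Y ∩ bigInter I (f ∘ suc))
    open ICM-Solver (∩-idempotentCommutativeMonoid k) using (_⊕_; _⊜_) renaming (solve to solve-∩)
    μ-split-along-f₀ : μ (X ∩ R) ≡ μ ((X ∩ f zero) ∩ R) + μ (X ∩ (∁ (f zero) ∩ R))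
    μ-split-along-f₀ = trans (μ-split (X ∩ R) (f zero)) (cong₂ (λ A B → μ A + μ B)
      (solve-∩ 3 (λ x r f₀ → (x ⊕ r) ⊕ f₀ ⊜ (x ⊕ f₀) ⊕ r) refl X R (f zero))
      (solve-∩ 3 (λ x r f₀ → (x ⊕ r) ⊕ f₀ ⊜ x ⊕ (f₀ ⊕ r)) refl X R (∁ (f zero))))
    inside-term : ∀ I → g (inside ∷ I) ≡ - term (X ∩ f zero) I
    inside-term I = begin
      - signℚ ∣ I ∣ * μ (X ∩ bigInter (inside ∷ I) f)
        ≡⟨ cong (λ B → - signℚ ∣ I ∣ * μ (X ∩ B)) (bigInter-∷ inside I f) ⟩
      - signℚ ∣ I ∣ * μ (X ∩ (f zero ∩ bigInter I (f ∘ suc)))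
        ≡⟨ cong (λ B → - signℚ ∣ I ∣ * μ B) (sym (∩-assoc X (f zero) _)) ⟩
      - signℚ ∣ I ∣ * μ ((X ∩ f zero) ∩ bigInter I (f ∘ suc))
        ≡⟨ neg-distribˡ-* (signℚ ∣ I ∣) _ ⟨
      - term (X ∩ f zero) I ∎
    outside-term : ∀ I → g (outside ∷ I) ≡ term X I
    outside-term I = cong (λ B → signℚ ∣ I ∣ * μ (X ∩ B)) (bigInter-∷ outside I f)

  μ-⋃-inclusion–exclusion : ∀ {n} (f : Fin n → Subset k) →
    μ (⋃ (tabulate f)) ≡ sumℚ (map (λ I → signℚ (∣ I ∣ ℕ.+ 1) * μ (bigInter I f)) (nonemptySubsets n))
  μ-⋃-inclusion–exclusion {n} f = begin
    μ U
      ≡⟨ solve 2 (λ u c → u := (u :+ c) :- c) refl (μ U) (μ (∁ U)) ⟩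
    (μ U + μ (∁ U)) - μ (∁ U)
      ≡⟨ cong₂ _-_ (sym (trans (μ-split ⊤ U) (cong₂ (λ A B → μ A + μ B) (∩-identityˡ U) (∩-identityˡ (∁ U)))))
                   μ-∁U ⟩
    μ ⊤ - (μ ⊤ + N)
      ≡⟨ solve 2 (λ t n → t :- (t :+ n) := :- n) refl (μ ⊤) N ⟩
    - N
      ≡⟨ sumℚ-map-neg g (nonemptySubsets n) ⟨
    sumℚ (map (λ I → - g I) (nonemptySubsets n))
      ≡⟨ sumℚ-map-cong (λ I → trans (neg-distribˡ-* (signℚ ∣ I ∣) _) (cong₂ _*_ (sym (signℚ-+1 ∣ I ∣))
                                                                                 (cong μ (∩-identityˡ _))))
                       (nonemptySubsets n) ⟩
    sumℚ (map (λ I → signℚ (∣ I ∣ ℕ.+ 1) * μ (bigInter I f)) (nonemptySubsets n)) ∎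
    where
    U = ⋃ (tabulate f)
    g : Subset n → ℚ
    g I = signℚ ∣ I ∣ * μ (⊤ ∩ bigInter I f)
    N = sumℚ (map g (nonemptySubsets n))
    g-⊥ : g ⊥ ≡ μ ⊤
    g-⊥ = begin
      signℚ ∣ ⊥ {n} ∣ * μ (⊤ ∩ bigInter ⊥ f) ≡⟨ cong₂ (λ r B → signℚ r * μ (⊤ ∩ B)) (∣⊥∣≡0 n) (bigInter-⊥ f) ⟩
      1ℚ * μ (⊤ ∩ ⊤)                         ≡⟨ *-identityˡ _ ⟩
      μ (⊤ ∩ ⊤)                              ≡⟨ cong μ (∩-identityˡ ⊤) ⟩
      μ ⊤                                    ∎
    μ-∁U : μ (∁ U) ≡ μ ⊤ + N
    μ-∁U = begin
      μ (∁ U)                          ≡⟨ cong μ (trans (∁-⋃-tabulate f) (sym (∩-identityˡ _))) ⟩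
      μ (⊤ ∩ ⋂ (tabulate (∁ ∘ f)))     ≡⟨ μ-∩-⋂∁ n f ⊤ ⟩
      sumℚ (map g (allSubsets n))      ≡⟨ sumℚ-allSubsets g ⟩
      g ⊥ + N                          ≡⟨ cong (_+ N) g-⊥ ⟩
      μ ⊤ + N                          ∎

fromℚᵘ-homo-* : ∀ p q → fromℚᵘ (p ℚᵘ.* q) ≡ fromℚᵘ p * fromℚᵘ q
fromℚᵘ-homo-* p q = begin
  fromℚᵘ (p ℚᵘ.* q)
    ≡⟨ fromℚᵘ-cong (ℚᵘ.*-cong (ℚᵘ.≃-sym (toℚᵘ-fromℚᵘ p)) (ℚᵘ.≃-sym (toℚᵘ-fromℚᵘ q))) ⟩
  fromℚᵘ (toℚᵘ (fromℚᵘ p) ℚᵘ.* toℚᵘ (fromℚᵘ q))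
    ≡⟨ fromℚᵘ-cong (toℚᵘ-homo-* (fromℚᵘ p) (fromℚᵘ q)) ⟨
  fromℚᵘ (toℚᵘ (fromℚᵘ p * fromℚᵘ q))
    ≡⟨ fromℚᵘ-toℚᵘ _ ⟩
  fromℚᵘ p * fromℚᵘ q ∎

1/[m*n]≡1/m*1/n : ∀ m n .{{_ : NonZero m}} .{{_ : NonZero n}} →
  (ℤ.+ 1 / (m ℕ.* n)) {{m*n≢0 m n}} ≡ (ℤ.+ 1 / m) * (ℤ.+ 1 / n)
1/[m*n]≡1/m*1/n (suc m) (suc n) = fromℚᵘ-homo-* (ℚᵘ.mkℚᵘ (ℤ.+ 1) m) (ℚᵘ.mkℚᵘ (ℤ.+ 1) n)

1/[_!] : ℕ → ℚ
1/[ m !] = (ℤ.+ 1 / (m !)) {{m !≢0}}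

1/[_!]^_ : ℕ → ℕ → ℚ
1/[ m !]^ r = (ℤ.+ 1 / ((m !) ^ r)) {{m^n≢0 (m !) r {{m !≢0}}}}

evalTerm : {k m : ℕ} → ((Fin m → Subset k) → ℚ) → ℚ × (Fin m → Subset k) → ℚ
evalTerm F (c , y) = c * F y

linearExt : {k m : ℕ} → ((Fin m → Subset k) → ℚ) → Tensor k m → ℚ
linearExt F = sumℚ ∘ map (evalTerm F)

module _ {k m : ℕ} where

  linearExt-++ : ∀ F (u v : Tensor k m) → linearExt F (u ++ v) ≡ linearExt F u + linearExt F v
  linearExt-++ F u v = trans (cong sumℚ (List.map-++ (evalTerm F) u v)) (sumℚ-++ (map (evalTerm F) u) _)

  linearExt-scaleT : ∀ F c (t : Tensor k m) → linearExt F (scaleT c t) ≡ c * linearExt F t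
  linearExt-scaleT F c []            = sym (*-zeroʳ c)
  linearExt-scaleT F c ((d , y) ∷ t) =
    trans (cong₂ _+_ (*-assoc c d (F y)) (linearExt-scaleT F c t)) (sym (*-distribˡ-+ c _ _))

  linearExt-concatMap : {A : Set} → ∀ F (f : A → Tensor k m) xs →
    linearExt F (concatMap f xs) ≡ sumℚ (map (linearExt F ∘ f) xs)
  linearExt-concatMap F f []       = refl
  linearExt-concatMap F f (x ∷ xs) =
    trans (linearExt-++ F (f x) (concatMap f xs)) (cong (linearExt F (f x) +_) (linearExt-concatMap F f xs))

  linearExt-pureT : ∀ F (y : Fin m → Subset k) → linearExt F (pureT y) ≡ F y
  linearExt-pureT F y = trans (+-identityʳ _) (*-identityˡ _)

  linearExt-∪ᵗ-pureT : ∀ F (u : Tensor k m) z →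
    linearExt F (u ∪ᵗ pureT z) ≡ linearExt (λ y → F (λ j → y j ∪ z j)) u
  linearExt-∪ᵗ-pureT F []            z = refl
  linearExt-∪ᵗ-pureT F ((c , y) ∷ u) z =
    cong₂ _+_ (cong (_* F (λ j → y j ∪ z j)) (*-identityʳ c)) (linearExt-∪ᵗ-pureT F u z)

  linearExt-∪ˢ-pureT : ∀ F (u : Tensor k m) b →
    linearExt F (u ∪ˢ pureT b)
      ≡ 1/[ m !] * sumℚ (map (λ τ → linearExt (λ y → F (λ j → y j ∪ b (τ j))) u) (perms m))
  linearExt-∪ˢ-pureT F u b = begin
    linearExt F (u ∪ˢ pureT b)
      ≡⟨ linearExt-scaleT F 1/[ m !] (concatMap (λ τ → u ∪ᵗ permuteT τ (pureT b)) (perms m)) ⟩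
    1/[ m !] * linearExt F (concatMap (λ τ → u ∪ᵗ pureT (b ∘ τ)) (perms m))
      ≡⟨ cong (1/[ m !] *_) (linearExt-concatMap F (λ τ → u ∪ᵗ pureT (b ∘ τ)) (perms m)) ⟩
    1/[ m !] * sumℚ (map (λ τ → linearExt F (u ∪ᵗ pureT (b ∘ τ))) (perms m))
      ≡⟨ cong (1/[ m !] *_) (sumℚ-map-cong (λ τ → linearExt-∪ᵗ-pureT F u (b ∘ τ)) (perms m)) ⟩
    1/[ m !] * sumℚ (map (λ τ → linearExt (λ y → F (λ j → y j ∪ b (τ j))) u) (perms m)) ∎

-- It is not defined as y j ∪ ⋃ᵢ bᵢ (τᵢ j) (see unionPermuted-apply) because then r = 0
-- would give λ j → y j ∪ ⊥, which without function extensionality cannot be replaced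
-- by y under an arbitrary functional F.
unionPermuted : ∀ {k m} r → (Fin r → Fin m → Subset k) → (Fin r → Fin m → Fin m) →
  (Fin m → Subset k) → Fin m → Subset k
unionPermuted zero    b τ y = y
unionPermuted (suc r) b τ y = unionPermuted r (b ∘ suc) (τ ∘ suc) (λ j → y j ∪ b zero (τ zero j))

unionPermuted-apply : ∀ {k m} r b τ (y : Fin m → Subset k) j →
  unionPermuted r b τ y j ≡ y j ∪ ⋃ (tabulate (λ i → b i (τ i j)))
unionPermuted-apply zero    b τ y j = sym (∪-identityʳ (y j))
unionPermuted-apply (suc r) b τ y j =
  trans (unionPermuted-apply r (b ∘ suc) (τ ∘ suc) _ j) (∪-assoc (y j) _ _)

linearExt-foldl-∪ˢ : ∀ {k m} r (b : Fin r → Fin m → Subset k) u F →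
  linearExt F (foldl _∪ˢ_ u (tabulate (pureT ∘ b)))
    ≡ 1/[ m !]^ r * sumℚ (map (λ τ → linearExt (F ∘ unionPermuted r b τ) u) (permTuples m r))
linearExt-foldl-∪ˢ zero b u F = sym (trans (*-identityˡ _) (+-identityʳ _))
linearExt-foldl-∪ˢ {k} {m} (suc r) b u F = begin
  linearExt F (foldl _∪ˢ_ (u ∪ˢ pureT (b zero)) (tabulate (pureT ∘ b ∘ suc)))
    ≡⟨ linearExt-foldl-∪ˢ r (b ∘ suc) (u ∪ˢ pureT (b zero)) F ⟩
  1/[ m !]^ r * sumℚ (map (λ τ′ → linearExt (F ∘ unionPermuted r (b ∘ suc) τ′) (u ∪ˢ pureT (b zero))) τs)
    ≡⟨ cong (1/[ m !]^ r *_) (sumℚ-map-cong (λ τ′ → linearExt-∪ˢ-pureT _ u (b zero)) τs) ⟩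
  1/[ m !]^ r * sumℚ (map (λ τ′ → 1/[ m !] * sumℚ (map (λ τ → E τ τ′) (perms m))) τs)
    ≡⟨ cong (1/[ m !]^ r *_) (sumℚ-map-*ˡ 1/[ m !] (λ τ′ → sumℚ (map (λ τ → E τ τ′) (perms m))) τs) ⟩
  1/[ m !]^ r * (1/[ m !] * sumℚ (map (λ τ′ → sumℚ (map (λ τ → E τ τ′) (perms m))) τs))
    ≡⟨ cong (λ x → 1/[ m !]^ r * (1/[ m !] * x)) (sumℚ-map-swap (λ τ′ τ → E τ τ′) τs (perms m)) ⟩
  1/[ m !]^ r * (1/[ m !] * Σ)
    ≡⟨ trans (sym (*-assoc (1/[ m !]^ r) 1/[ m !] Σ)) (cong (_* Σ) (*-comm (1/[ m !]^ r) 1/[ m !])) ⟩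
  (1/[ m !] * 1/[ m !]^ r) * Σ
    ≡⟨ cong (_* Σ) (1/[m*n]≡1/m*1/n (m !) ((m !) ^ r) {{m !≢0}} {{m^n≢0 (m !) r {{m !≢0}}}}) ⟨
  1/[ m !]^ suc r * Σ
    ≡⟨ cong (1/[ m !]^ suc r *_) (sumℚ-map-cong (λ τ → sumℚ-map-∘ H (consF τ) τs) (perms m)) ⟩
  1/[ m !]^ suc r * sumℚ (map (λ τ → sumℚ (map H (map (consF τ) τs))) (perms m))
    ≡⟨ cong (1/[ m !]^ suc r *_) (sumℚ-map-concatMap H (λ τ → map (consF τ) τs) (perms m)) ⟨
  1/[ m !]^ suc r * sumℚ (map H (permTuples m (suc r))) ∎
  where
  τs = permTuples m r
  E : (Fin m → Fin m) → (Fin r → Fin m → Fin m) → ℚ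
  E τ τ′ = linearExt (λ y → F (unionPermuted r (b ∘ suc) τ′ (λ j → y j ∪ b zero (τ j)))) u
  H : (Fin (suc r) → Fin m → Fin m) → ℚ
  H τ = linearExt (F ∘ unionPermuted (suc r) b τ) u
  Σ = sumℚ (map (λ τ → sumℚ (map (E τ) τs)) (perms m))

p₁≡linearExt : ∀ {k m} (μ : Subset k → ℚ) (t : Tensor k m) →
  p₁ μ t ≡ linearExt (λ y → sumℚ (map (μ ∘ y) (allFin m))) t
p₁≡linearExt μ t = refl

corollary4p5 : (k m n : ℕ) → 1 ≤ k → 1 ≤ m → 1 ≤ n →
    (μ : Subset k → ℚ) → IsMeasure μ →
    (a : Fin n → Fin m → Subset k) →
    p₁ μ (iterUnion (map (λ i → pureT (a i)) (allFin n))) ≡ rhs m n μ a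
corollary4p5 k m zero    _ _ () μ μ-additive a
corollary4p5 k m (suc r) _ _ _  μ μ-additive a = begin
  p₁ μ (foldl _∪ˢ_ (pureT (a zero)) (map (pureT ∘ a) (tabulate suc)))
    ≡⟨ p₁≡linearExt μ (foldl _∪ˢ_ (pureT (a zero)) (map (pureT ∘ a) (tabulate suc))) ⟩
  linearExt P (foldl _∪ˢ_ (pureT (a zero)) (map (pureT ∘ a) (tabulate suc)))
    ≡⟨ cong (linearExt P ∘ foldl _∪ˢ_ (pureT (a zero))) (List.map-tabulate suc (pureT ∘ a)) ⟩
  linearExt P (foldl _∪ˢ_ (pureT (a zero)) (tabulate (pureT ∘ a ∘ suc)))
    ≡⟨ linearExt-foldl-∪ˢ r (a ∘ suc) (pureT (a zero)) P ⟩
  1/[ m !]^ r * sumℚ (map (λ τ → linearExt (P ∘ unionPermuted r (a ∘ suc) τ) (pureT (a zero))) τs)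
    ≡⟨ cong (1/[ m !]^ r *_) (sumℚ-map-cong inclusion–exclusion τs) ⟩
  1/[ m !]^ r * sumℚ (map (Q ∘ consF id) τs)
    ≡⟨ cong (1/[ m !]^ r *_) (sumℚ-map-∘ Q (consF id) τs) ⟩
  rhs m (suc r) μ a ∎
  where
  τs = permTuples m r
  P : (Fin m → Subset k) → ℚ
  P y = sumℚ (map (μ ∘ y) (allFin m))
  Q : (Fin (suc r) → Fin m → Fin m) → ℚ
  Q σ = sumℚ (map (λ j → sumℚ (map (λ I → signℚ (∣ I ∣ ℕ.+ 1) * μ (bigInter I (λ i → a i (σ i j))))
                                   (nonemptySubsets (suc r)))) (allFin m))
  inclusion–exclusion : ∀ τ → linearExt (P ∘ unionPermuted r (a ∘ suc) τ) (pureT (a zero)) ≡ Q (consF id τ)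
  inclusion–exclusion τ =
    trans (linearExt-pureT (P ∘ unionPermuted r (a ∘ suc) τ) (a zero))
          (sumℚ-map-cong (λ j → trans (cong μ (unionPermuted-apply r (a ∘ suc) τ (a zero) j))
                                      (μ-⋃-inclusion–exclusion {μ = μ} μ-additive (λ i → a i (consF id τ i j))))
                         (allFin m))
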